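{- Let $n\ge 4$ be an integer and let $C_n$ be the cycle on $n$ vertices. Then $C_{tr}(C_n)=4$ if $n\equiv 0 \pmod 4$, and $C_{tr}(C_n)=3$ otherwise.
   Context: A set $S\subseteq V$ is a total restrained dominating set (TRD-set) of $G=(V,E)$ if every vertex of $V\setminus S$ is adjacent to at least one vertex of $S$ and to at least one other vertex of $V\setminus S$, and every vertex of $S$ is adjacent to at least one other vertex of $S$. Two disjoint sets $X,Y\subseteq V$ form a total restrained coalition if neither is a TRD-set but $X\cup Y$ is a TRD-set. A trc-partition of $G$ is a partition $\Phi$ of $V$ such that no member of $\Phi$ is a TRD-set and each member forms a total restrained coalition with some other member of $\Phi$. $C_{tr}(G)$ is the maximum cardinality of a trc-partition of $G$. -}

module Defs where

open import Data.Nat using (ℕ; zero; suc; _≤_)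
open import Data.Fin using (Fin; toℕ)
open import Data.Product using (Σ; ∃; _×_)
open import Data.Sum using (_⊎_)
open import Relation.Nullary using (¬_)
open import Relation.Binary.PropositionalEquality using (_≡_)
open import Function.Definitions using (Surjective)

Adjacency : ℕ → Set₁
Adjacency n = Fin n → Fin n → Set

VSet : ℕ → Set₁
VSet n = Fin n → Set

_∪_ : ∀ {n} → VSet n → VSet n → VSet n
(X ∪ Y) v = X v ⊎ Y v

IsTRD : ∀ {n} → Adjacency n → VSet n → Set
IsTRD {n} Adj S =
  (∀ (v : Fin n) → ¬ S v →
     (∃ λ u → S u × Adj v u) × (∃ λ w → ¬ S w × ¬ (w ≡ v) × Adj v w))
  × (∀ (v : Fin n) → S v → ∃ λ u → S u × ¬ (u ≡ v) × Adj v u)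

IsTRCoalition : ∀ {n} → Adjacency n → VSet n → VSet n → Set
IsTRCoalition Adj X Y = ¬ IsTRD Adj X × ¬ IsTRD Adj Y × IsTRD Adj (X ∪ Y)

-- A partition of Fin n into k nonempty classes, given by a surjective
-- class-assignment map f : Fin n → Fin k; class i = f⁻¹(i).
Class : ∀ {n k} → (Fin n → Fin k) → Fin k → VSet n
Class f i v = f v ≡ i

IsTRCPartition : ∀ {n k} → Adjacency n → (Fin n → Fin k) → Set
IsTRCPartition {n} {k} Adj f =
  Surjective _≡_ _≡_ f
  × (∀ (i : Fin k) → ¬ IsTRD Adj (Class f i))
  × (∀ (i : Fin k) → ∃ λ j → ¬ (j ≡ i) × IsTRCoalition Adj (Class f i) (Class f j))

HasTRCPartition : ∀ {n} → Adjacency n → ℕ → Set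
HasTRCPartition {n} Adj k = Σ (Fin n → Fin k) (IsTRCPartition Adj)

CtrIs : ∀ {n} → Adjacency n → ℕ → Set
CtrIs Adj m = HasTRCPartition Adj m × (∀ k → HasTRCPartition Adj k → k ≤ m)

-- The cycle C_n on vertices 0,…,n-1: i ~ j iff j ≡ i ± 1 (mod n).
CycleAdj : (n : ℕ) → Adjacency n
CycleAdj n i j =
  suc (toℕ i) ≡ toℕ j
  ⊎ suc (toℕ j) ≡ toℕ i
  ⊎ (toℕ j ≡ 0 × suc (toℕ i) ≡ n)
  ⊎ (toℕ i ≡ 0 × suc (toℕ j) ≡ n)

-- On a cycle, S is a TRD-set iff every vertex has a neighbour in S and every vertex outside S
-- has a neighbour outside S. If v lies in neither of two disjoint totally dominating sets, the
-- vertex two steps after v lies in both; so such sets cover the cycle, each is the complement of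
-- the other, and membership then flips every two steps, forcing 4 ∣ n.
-- In a trc-partition with k ≥ 4 classes, join two classes when their union is a TRD-set. No class
-- is isolated, and by the above two disjoint edges force k = 4 and 4 ∣ n. Without disjoint edges
-- the graph is a star (k ≥ 4 excludes a triangle), and a class joined to all others is itself a
-- TRD-set, which is impossible. Residues mod 4, resp. the arcs {0,1}, {2,3}, {4,…,n−1}, give
-- partitions of orders 4 and 3.

module Submission where

open import Defs
open import Data.Nat using (ℕ; _≤_; _%_)
open import Relation.Nullary using (¬_)
open import Relation.Binary.PropositionalEquality using (_≡_)
open import Data.Product using (_×_)

open import Data.Bool.Base using (Bool; true; false; not; _∧_; _∨_)
open import Data.Bool.Properties using (not-involutive; not-¬)
open import Data.Empty using (⊥)
open import Data.Fin using (#_)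
open import Data.Fin.Base using (Fin; zero; suc; toℕ; fromℕ; fromℕ<; inject₁; lower₁)
open import Data.Fin.Properties
  using (toℕ-injective; toℕ<n; toℕ-fromℕ; toℕ-fromℕ<; toℕ-inject₁; toℕ-lower₁; injective⇒≤; any?)
  renaming (_≟_ to _≟ᶠ_)
open import Data.List.Base using (List; []; _∷_; length; lookup)
import Data.List.Membership.DecPropositional as DecMembership
open import Data.List.Relation.Unary.All using (All; []; _∷_)
open import Data.List.Relation.Unary.All.Properties using (¬Any⇒All¬)
open import Data.List.Relation.Unary.Any using (index)
open import Data.List.Relation.Unary.Any.Properties using (lookup-index)
open import Data.Nat.Base using (zero; suc; _+_; _*_; _<_; s≤s; s≤s⁻¹)
open import Data.Nat.Divisibility using (_∣_; divides; n∣m⇒m%n≡0; m%n≡0⇒n∣m)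
open import Data.Nat.GeneralisedArithmetic using (fold; fold-+)
open import Data.Nat.Properties
  using (_≟_; ≤-refl; ≤-trans; n≤1+n; <⇒≤; <⇒≢; <⇒≱; ≮⇒≥; ≤∧≢⇒<; 1+n≢n; suc-injective;
         +-comm; +-identityʳ; *-comm; *-assoc)
open import Data.Product using (∃; _,_; proj₁; proj₂)
open import Data.Sum using (_⊎_; inj₁; inj₂; [_,_]′; swap)
import Data.Sum as Sum
open import Function.Base using (_∘_; id)
open import Function.Bundles using (_⇔_; mk⇔; Equivalence)
open import Function.Consequences.Propositional using (strictlySurjective⇒surjective)
open import Function.Definitions using (Injective; StrictlySurjective)
open import Relation.Binary.PropositionalEquality
  using (_≢_; refl; sym; trans; cong; subst; module ≡-Reasoning)
open import Relation.Nullary using (Dec; yes; no; does; contradiction)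
open import Relation.Nullary.Decidable using (decidable-stable; _⊎-dec_)
open import Relation.Unary using (Decidable; ∁)

module _ {k : ℕ} where
  open DecMembership (_≟ᶠ_ {k}) using (_∈_; _∈?_; _∉?_)

  fresh : (xs : List (Fin k)) → length xs < k → ∃ λ r → All (r ≢_) xs
  fresh xs len<k with any? (λ r → r ∉? xs)
  ... | yes (r , r∉xs) = r , ¬Any⇒All¬ xs r∉xs
  ... | no none = contradiction (injective⇒≤ position-injective) (<⇒≱ len<k)
    where
    member : ∀ r → r ∈ xs
    member r = decidable-stable (r ∈? xs) (λ r∉xs → none (r , r∉xs))

    position-injective : Injective _≡_ _≡_ (λ r → index (member r))
    position-injective {r} {s} same = begin
      r                            ≡⟨ lookup-index (member r) ⟩
      lookup xs (index (member r)) ≡⟨ cong (lookup xs) same ⟩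
      lookup xs (index (member s)) ≡⟨ sym (lookup-index (member s)) ⟩
      s                            ∎
      where open ≡-Reasoning

NoDisjointEdges : ∀ {k} → (Fin k → Fin k → Set) → Set
NoDisjointEdges E = ∀ {a b c d} → E a b → E c d → c ≢ a → c ≢ b → d ≢ a → d ≢ b → ⊥

module _ {k} {E : Fin k → Fin k → Set} (E-sym : ∀ {i j} → E i j → E j i)
         (no-isolated : ∀ i → ∃ λ j → j ≢ i × E i j) (no-disjoint : NoDisjointEdges E) where

  private
    other-endpoint : ∀ {a b c d} → E a b → E c d → c ≢ a → c ≢ b → d ≡ a ⊎ d ≡ b
    other-endpoint {a} {b} {d = d} eab ecd c≢a c≢b with d ≟ᶠ a | d ≟ᶠ b
    ... | yes d≡a | _       = inj₁ d≡a
    ... | no _    | yes d≡b = inj₂ d≡b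
    ... | no d≢a  | no d≢b  = contradiction (no-disjoint eab ecd c≢a c≢b d≢a d≢b) λ ()

    no-triangle : 4 ≤ k → ∀ {x y r} → y ≢ x → r ≢ x → r ≢ y → E x y → E x r → ¬ E y r
    no-triangle 4≤k {x} {y} {r} y≢x r≢x r≢y exy exr eyr with fresh (x ∷ y ∷ r ∷ []) 4≤k
    ... | t , t≢x ∷ t≢y ∷ t≢r ∷ [] with no-isolated t
    ... | u , _ , etu with other-endpoint exy etu t≢x t≢y
    ... | inj₁ refl = [ y≢x ∘ sym , r≢x ∘ sym ]′ (other-endpoint eyr etu t≢y t≢r)
    ... | inj₂ refl = [ y≢x , r≢y ∘ sym ]′ (other-endpoint exr etu t≢x t≢r)

    -- An edge zq avoiding x has to meet both xy and xr, so it is the forbidden edge yr.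
    centre : 4 ≤ k → ∀ {x y r} → y ≢ x → r ≢ x → r ≢ y → E x y → E x r → ∀ z → z ≢ x → E x z
    centre 4≤k {x} {y} {r} y≢x r≢x r≢y exy exr z z≢x with no-isolated z
    ... | q , _ , ezq with q ≟ᶠ x
    ...   | yes refl = E-sym ezq
    ...   | no q≢x with other-endpoint ezq exy (z≢x ∘ sym) (q≢x ∘ sym)
                      | other-endpoint ezq exr (z≢x ∘ sym) (q≢x ∘ sym)
    ...     | inj₁ y≡z  | inj₁ r≡z  = contradiction (trans r≡z (sym y≡z)) r≢y
    ...     | inj₂ y≡q  | inj₂ r≡q  = contradiction (trans r≡q (sym y≡q)) r≢y
    ...     | inj₁ refl | inj₂ refl = contradiction ezq (no-triangle 4≤k y≢x r≢x r≢y exy exr)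
    ...     | inj₂ refl | inj₁ refl = contradiction (E-sym ezq) (no-triangle 4≤k y≢x r≢x r≢y exy exr)

  universal-vertex : 4 ≤ k → ∃ λ x → ∀ z → z ≢ x → E x z
  universal-vertex 4≤k@(s≤s _) with no-isolated zero
  ... | j , j≢0 , e0j with fresh (zero ∷ j ∷ []) (≤-trans (n≤1+n 3) 4≤k)
  ... | r , r≢0 ∷ r≢j ∷ [] with no-isolated r
  ... | s , _ , ers with other-endpoint e0j ers r≢0 r≢j
  ... | inj₁ refl = zero , centre 4≤k j≢0 r≢0 r≢j e0j (E-sym ers)
  ... | inj₂ refl = j , centre 4≤k (j≢0 ∘ sym) r≢j r≢0 (E-sym e0j) (E-sym ers)

fold-not-fixed⇒even : ∀ j {x} → fold x not j ≡ x → 2 ∣ j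
fold-not-fixed⇒even zero          _ = divides 0 refl
fold-not-fixed⇒even (suc zero)    e = contradiction (sym e) (not-¬ refl)
fold-not-fixed⇒even (suc (suc j)) e with fold-not-fixed⇒even j (trans (sym (not-involutive _)) e)
... | divides q j≡q*2 = divides (suc q) (cong (2 +_) j≡q*2)

-- A sign flip every two steps, g (2 + t) = not (g t), gives g (2j) = notʲ (g 0); so a period p
-- is even (compare g (2p) with g 0), and so is p/2 (compare g p with g 0).
module _ (g : ℕ → Bool) (flips : ∀ t → g (2 + t) ≡ not (g t)) where

  antiperiodic-at-even : ∀ j → g (j * 2) ≡ fold (g 0) not j
  antiperiodic-at-even zero    = refl
  antiperiodic-at-even (suc j) = trans (flips (j * 2)) (cong not (antiperiodic-at-even j))

  antiperiodic⇒4∣period : ∀ {p} → (∀ t → g (p + t) ≡ g t) → 4 ∣ p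
  antiperiodic⇒4∣period {p} periodic = divides l (begin
      p         ≡⟨ p≡i*2 ⟩
      i * 2     ≡⟨ cong (_* 2) i≡l*2 ⟩
      l * 2 * 2 ≡⟨ *-assoc l 2 2 ⟩
      l * 4     ∎)
    where
    open ≡-Reasoning

    at-multiple : ∀ q → g (q * p) ≡ g 0
    at-multiple zero    = refl
    at-multiple (suc q) = trans (periodic (q * p)) (at-multiple q)

    p-even : 2 ∣ p
    p-even = fold-not-fixed⇒even p (begin
      fold (g 0) not p ≡⟨ sym (antiperiodic-at-even p) ⟩
      g (p * 2)        ≡⟨ cong g (*-comm p 2) ⟩
      g (2 * p)        ≡⟨ at-multiple 2 ⟩
      g 0              ∎)

    i : ℕ
    i = _∣_.quotient p-even

    p≡i*2 : p ≡ i * 2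
    p≡i*2 = _∣_.equality p-even

    i-even : 2 ∣ i
    i-even = fold-not-fixed⇒even i (begin
      fold (g 0) not i ≡⟨ sym (antiperiodic-at-even i) ⟩
      g (i * 2)        ≡⟨ cong g (sym p≡i*2) ⟩
      g p              ≡⟨ cong g (sym (+-identityʳ p)) ⟩
      g (p + 0)        ≡⟨ periodic 0 ⟩
      g 0              ∎)

    l : ℕ
    l = _∣_.quotient i-even

    i≡l*2 : i ≡ l * 2
    i≡l*2 = _∣_.equality i-even

exactly-one : ∀ {A C : Set} (a? : Dec A) (c? : Dec C) → A ⊎ C → ¬ A ⊎ ¬ C → does c? ≡ not (does a?)
exactly-one (yes _) (no _)  _          _          = refl
exactly-one (no _)  (yes _) _          _          = refl
exactly-one (yes a) (yes c) _          ¬a⊎¬c      = contradiction ¬a⊎¬c [ contradiction a , contradiction c ]′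
exactly-one (no ¬a) (no ¬c) a⊎c        _          = contradiction a⊎c [ ¬a , ¬c ]′

-- The local condition for a set S at a vertex of a cycle, from the memberships of
-- (predecessor, vertex, successor): S meets the two neighbours, and if the vertex is
-- outside S, so does the complement.
trdWindow : Bool → Bool → Bool → Bool
trdWindow p s c = (p ∨ c) ∧ (s ∨ not (p ∧ c))

trdWindow-reflects : ∀ {A S C : Set} (a? : Dec A) (s? : Dec S) (c? : Dec C) →
  trdWindow (does a?) (does s?) (does c?) ≡ true ⇔ ((A ⊎ C) × (¬ S → ¬ A ⊎ ¬ C))
trdWindow-reflects a? s? c? = mk⇔ (sound a? s? c?) (complete a? s? c?)
  where
  sound : ∀ {A S C : Set} (a? : Dec A) (s? : Dec S) (c? : Dec C) →
    trdWindow (does a?) (does s?) (does c?) ≡ true → (A ⊎ C) × (¬ S → ¬ A ⊎ ¬ C)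
  sound (yes a) (yes s) (yes _)  _  = inj₁ a , contradiction s
  sound (yes _) (no _)  (yes _)  ()
  sound (yes a) _       (no ¬c)  _  = inj₁ a , λ _ → inj₂ ¬c
  sound (no ¬a) _       (yes c)  _  = inj₂ c , λ _ → inj₁ ¬a
  sound (no _)  _       (no _)   ()

  complete : ∀ {A S C : Set} (a? : Dec A) (s? : Dec S) (c? : Dec C) →
    (A ⊎ C) × (¬ S → ¬ A ⊎ ¬ C) → trdWindow (does a?) (does s?) (does c?) ≡ true
  complete (yes _) (yes _)  (yes _) _              = refl
  complete (yes a) (no ¬s)  (yes c) (_ , ¬a⊎¬c)    = contradiction (¬a⊎¬c ¬s) [ contradiction a , contradiction c ]′
  complete (yes _) (yes _)  (no _)  _              = refl
  complete (yes _) (no _)   (no _)  _              = refl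
  complete (no _)  (yes _)  (yes _) _              = refl
  complete (no _)  (no _)   (yes _) _              = refl
  complete (no ¬a) _        (no ¬c) (a⊎c , _)      = contradiction a⊎c [ ¬a , ¬c ]′

IsTRD-resp : ∀ {n} {Adj : Adjacency n} {S S′ : VSet n} →
  (∀ {v} → S v → S′ v) → (∀ {v} → S′ v → S v) → IsTRD Adj S → IsTRD Adj S′
IsTRD-resp to from (outside , inside) =
  (λ v v∉S′ → let (u , u∈S , v~u) , (w , w∉S , w≢v , v~w) = outside v (v∉S′ ∘ to)
              in (u , to u∈S , v~u) , (w , w∉S ∘ from , w≢v , v~w)) ,
  (λ v v∈S′ → let (u , u∈S , u≢v , v~u) = inside v (from v∈S′) in u , to u∈S , u≢v , v~u)

IsTRD-∪-comm : ∀ {n} {Adj : Adjacency n} {X Y : VSet n} → IsTRD Adj (X ∪ Y) → IsTRD Adj (Y ∪ X)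
IsTRD-∪-comm = IsTRD-resp swap swap

IsTRCPartition-intro : ∀ {n k} {Adj : Adjacency n} {f : Fin n → Fin k} → StrictlySurjective _≡_ f →
  (∀ i → ¬ IsTRD Adj (Class f i)) → (partner : Fin k → Fin k) → (∀ i → partner i ≢ i) →
  (∀ i → IsTRD Adj (Class f i ∪ Class f (partner i))) → IsTRCPartition Adj f
IsTRCPartition-intro surjective alone partner partner≢ together =
  strictlySurjective⇒surjective surjective , alone ,
  λ i → partner i , partner≢ i , alone i , alone (partner i) , together i

Class? : ∀ {n k} (f : Fin n → Fin k) (i : Fin k) → Decidable (Class f i)
Class? f i v = f v ≟ᶠ i

Class∪? : ∀ {n k} (f : Fin n → Fin k) (i j : Fin k) → Decidable (Class f i ∪ Class f j)
Class∪? f i j v = (f v ≟ᶠ i) ⊎-dec (f v ≟ᶠ j)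

TRDWindows : ∀ {C : Set} {Q : C → Set} → Decidable Q → (C → C → C → Set) → Set
TRDWindows Q? W = ∀ {a s c} → W a s c → trdWindow (does (Q? a)) (does (Q? s)) (does (Q? c)) ≡ true

-- The cycle on the vertices 0, …, m

module Cycle (m : ℕ) (m≢0 : m ≢ 0) where

  Vertex : Set
  Vertex = Fin (suc m)

  Adj : Adjacency (suc m)
  Adj = CycleAdj (suc m)

  nxt : Vertex → Vertex
  nxt v with m ≟ toℕ v
  ... | yes _   = zero
  ... | no m≢v  = suc (lower₁ v m≢v)

  prv : Vertex → Vertex
  prv zero    = fromℕ m
  prv (suc v) = inject₁ v

  infix 4 _↦_

  -- The first and third disjuncts of CycleAdj: position s comes right after position t.
  _↦_ : ℕ → ℕ → Set
  t ↦ s = suc t ≡ s ⊎ (s ≡ 0 × suc t ≡ suc m)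

  ↦-nxt : ∀ v → toℕ v ↦ toℕ (nxt v)
  ↦-nxt v with m ≟ toℕ v
  ... | yes m≡v = inj₂ (refl , cong suc (sym m≡v))
  ... | no m≢v  = inj₁ (sym (cong suc (toℕ-lower₁ v m≢v)))

  ↦-prv : ∀ v → toℕ (prv v) ↦ toℕ v
  ↦-prv zero    = inj₂ (refl , cong suc (toℕ-fromℕ m))
  ↦-prv (suc v) = inj₁ (cong suc (toℕ-inject₁ v))

  ↦-functional : ∀ {v w w′ : Vertex} → toℕ v ↦ toℕ w → toℕ v ↦ toℕ w′ → w ≡ w′
  ↦-functional           (inj₁ e)       (inj₁ e′)       = toℕ-injective (trans (sym e) e′)
  ↦-functional {w = w}   (inj₁ e)       (inj₂ (_ , e′)) = contradiction (trans (sym e) e′) (<⇒≢ (toℕ<n w))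
  ↦-functional {w′ = w′} (inj₂ (_ , e)) (inj₁ e′)       = contradiction (trans (sym e′) e) (<⇒≢ (toℕ<n w′))
  ↦-functional           (inj₂ (e , _)) (inj₂ (e′ , _)) = toℕ-injective (trans e (sym e′))

  ↦-injective : ∀ {v v′ w : Vertex} → toℕ v ↦ toℕ w → toℕ v′ ↦ toℕ w → v ≡ v′
  ↦-injective (inj₁ e)       (inj₁ e′)       = toℕ-injective (suc-injective (trans e (sym e′)))
  ↦-injective (inj₁ e)       (inj₂ (e′ , _)) = contradiction (trans e e′) λ ()
  ↦-injective (inj₂ (e , _)) (inj₁ e′)       = contradiction (trans e′ e) λ ()
  ↦-injective (inj₂ (_ , e)) (inj₂ (_ , e′)) = toℕ-injective (suc-injective (trans e (sym e′)))

  ↦-irreflexive : ∀ {t} → ¬ t ↦ t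
  ↦-irreflexive (inj₁ e)         = 1+n≢n e
  ↦-irreflexive (inj₂ (t≡0 , e)) = m≢0 (trans (sym (suc-injective e)) t≡0)

  prv-nxt : ∀ v → prv (nxt v) ≡ v
  prv-nxt v = ↦-injective (↦-prv (nxt v)) (↦-nxt v)

  nxt≢ : ∀ v → nxt v ≢ v
  nxt≢ v e = ↦-irreflexive (subst (λ w → toℕ v ↦ toℕ w) e (↦-nxt v))

  prv≢ : ∀ v → prv v ≢ v
  prv≢ v e = ↦-irreflexive (subst (λ u → toℕ u ↦ toℕ v) e (↦-prv v))

  Adj⇒↦ : ∀ {v w} → Adj v w → toℕ v ↦ toℕ w ⊎ toℕ w ↦ toℕ v
  Adj⇒↦ (inj₁ e)                 = inj₁ (inj₁ e)
  Adj⇒↦ (inj₂ (inj₁ e))          = inj₂ (inj₁ e)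
  Adj⇒↦ (inj₂ (inj₂ (inj₁ e)))   = inj₁ (inj₂ e)
  Adj⇒↦ (inj₂ (inj₂ (inj₂ e)))   = inj₂ (inj₂ e)

  ↦⇒Adj : ∀ {v w} → toℕ v ↦ toℕ w ⊎ toℕ w ↦ toℕ v → Adj v w
  ↦⇒Adj (inj₁ (inj₁ e)) = inj₁ e
  ↦⇒Adj (inj₂ (inj₁ e)) = inj₂ (inj₁ e)
  ↦⇒Adj (inj₁ (inj₂ e)) = inj₂ (inj₂ (inj₁ e))
  ↦⇒Adj (inj₂ (inj₂ e)) = inj₂ (inj₂ (inj₂ e))

  Adj⇒nxt⊎prv : ∀ {v w} → Adj v w → w ≡ nxt v ⊎ w ≡ prv v
  Adj⇒nxt⊎prv {v} v~w with Adj⇒↦ v~w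
  ... | inj₁ v↦w = inj₁ (↦-functional v↦w (↦-nxt v))
  ... | inj₂ w↦v = inj₂ (↦-injective w↦v (↦-prv v))

  Adj-nxt : ∀ v → Adj v (nxt v)
  Adj-nxt v = ↦⇒Adj (inj₁ (↦-nxt v))

  Adj-prv : ∀ v → Adj v (prv v)
  Adj-prv v = ↦⇒Adj (inj₂ (↦-prv v))

  Dominates : VSet (suc m) → Vertex → Set
  Dominates S v = S (prv v) ⊎ S (nxt v)

  TotallyDominating : VSet (suc m) → Set
  TotallyDominating S = ∀ v → Dominates S v

  Adj⇒Dominates : ∀ {S : VSet (suc m)} {v w} → Adj v w → S w → Dominates S v
  Adj⇒Dominates v~w w∈S with Adj⇒nxt⊎prv v~w
  ... | inj₁ refl = inj₂ w∈S
  ... | inj₂ refl = inj₁ w∈S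

  Dominates⇒Adj : ∀ {S : VSet (suc m)} {v} → Dominates S v → ∃ λ u → S u × u ≢ v × Adj v u
  Dominates⇒Adj {v = v} (inj₁ prv∈S) = prv v , prv∈S , prv≢ v , Adj-prv v
  Dominates⇒Adj {v = v} (inj₂ nxt∈S) = nxt v , nxt∈S , nxt≢ v , Adj-nxt v

  TRDAt : VSet (suc m) → Vertex → Set
  TRDAt S v = Dominates S v × (¬ S v → Dominates (∁ S) v)

  IsTRD⇒TRDAt : ∀ {S} → Decidable S → IsTRD Adj S → ∀ v → TRDAt S v
  IsTRD⇒TRDAt {S} S? (outside , inside) v = dominated (S? v) , restrained
    where
    dominated : Dec (S v) → Dominates S v
    dominated (yes v∈S) = let (_ , u∈S , _ , v~u) = inside v v∈S in Adj⇒Dominates {S} v~u u∈S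
    dominated (no v∉S)  = let (_ , u∈S , v~u) = proj₁ (outside v v∉S) in Adj⇒Dominates {S} v~u u∈S

    restrained : ¬ S v → Dominates (∁ S) v
    restrained v∉S = let (_ , w∉S , _ , v~w) = proj₂ (outside v v∉S) in Adj⇒Dominates {∁ S} v~w w∉S

  TRDAt⇒IsTRD : ∀ {S} → (∀ v → TRDAt S v) → IsTRD Adj S
  TRDAt⇒IsTRD {S} local =
    (λ v v∉S → let (u , u∈S , _ , v~u) = Dominates⇒Adj {S} (proj₁ (local v))
               in (u , u∈S , v~u) , Dominates⇒Adj {∁ S} (proj₂ (local v) v∉S)) ,
    (λ v _ → Dominates⇒Adj {S} (proj₁ (local v)))

  IsTRD⇒TotallyDominating : ∀ {S} → Decidable S → IsTRD Adj S → TotallyDominating S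
  IsTRD⇒TotallyDominating S? trd v = proj₁ (IsTRD⇒TRDAt S? trd v)

  -- nxt v is adjacent only to v and nxt (nxt v).
  TotallyDominating-skip : ∀ {S} → TotallyDominating S → ∀ {v} → ¬ S v → S (nxt (nxt v))
  TotallyDominating-skip {S} td {v} v∉S with td (nxt v)
  ... | inj₁ prv-nxt∈S = contradiction (subst S (prv-nxt v) prv-nxt∈S) v∉S
  ... | inj₂ nxt-nxt∈S = nxt-nxt∈S

  disjoint-totallyDominating-cover : ∀ {S S′} → TotallyDominating S → TotallyDominating S′ →
    (∀ v → S v → S′ v → ⊥) → ∀ v → ¬ S v → ¬ S′ v → ⊥
  disjoint-totallyDominating-cover {S} {S′} td td′ disjoint v v∉S v∉S′ =
    disjoint _ (TotallyDominating-skip {S} td v∉S) (TotallyDominating-skip {S′} td′ v∉S′)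

  walk : ℕ → Vertex
  walk t = fold zero nxt t

  toℕ-walk : ∀ t → t ≤ m → toℕ (walk t) ≡ t
  toℕ-walk zero    _   = refl
  toℕ-walk (suc t) t<m with ↦-nxt (walk t)
  ... | inj₁ e       = trans (sym e) (cong suc (toℕ-walk t (<⇒≤ t<m)))
  ... | inj₂ (_ , e) =
    contradiction (suc-injective (trans (cong suc (sym (toℕ-walk t (<⇒≤ t<m)))) e)) (<⇒≢ t<m)

  walk-around : walk (suc m) ≡ zero
  walk-around with ↦-nxt (walk m)
  ... | inj₁ e       =
    contradiction (trans (sym e) (cong suc (toℕ-walk m ≤-refl))) (<⇒≢ (toℕ<n (nxt (walk m))))
  ... | inj₂ (e , _) = toℕ-injective e

  antiperiodic⇒4∣n : (b : Vertex → Bool) → (∀ v → b (nxt (nxt v)) ≡ not (b v)) → 4 ∣ suc m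
  antiperiodic⇒4∣n b flips = antiperiodic⇒4∣period (b ∘ walk) (flips ∘ walk) (cong b ∘ periodic)
    where
    open ≡-Reasoning

    periodic : ∀ t → walk (suc m + t) ≡ walk t
    periodic t = begin
      walk (suc m + t)          ≡⟨ cong walk (+-comm (suc m) t) ⟩
      walk (t + suc m)          ≡⟨ fold-+ zero nxt t ⟩
      fold (walk (suc m)) nxt t ≡⟨ cong (λ v → fold v nxt t) walk-around ⟩
      walk t                    ∎

  -- Every vertex has exactly one neighbour in S, since S and its complement both dominate;
  -- so membership flips every two steps.
  disjoint-totallyDominating⇒4∣n : ∀ {S S′} → Decidable S → TotallyDominating S → TotallyDominating S′ →
    (∀ v → S v → S′ v → ⊥) → 4 ∣ suc m
  disjoint-totallyDominating⇒4∣n {S} S? td td′ disjoint = antiperiodic⇒4∣n (does ∘ S?) alternates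
    where
    td∁ : TotallyDominating (∁ S)
    td∁ v = Sum.map (λ s′ s → disjoint _ s s′) (λ s′ s → disjoint _ s s′) (td′ v)

    alternates : ∀ v → does (S? (nxt (nxt v))) ≡ not (does (S? v))
    alternates v = subst (λ u → does (S? (nxt (nxt v))) ≡ not (does (S? u))) (prv-nxt v)
      (exactly-one (S? (prv (nxt v))) (S? (nxt (nxt v))) (td (nxt v)) (td∁ (nxt v)))

  data Around : ℕ → ℕ → ℕ → Set where
    first  : Around m 0 1
    middle : ∀ {t} → 2 + t ≤ m → Around t (1 + t) (2 + t)
    last   : ∀ {t} → 1 + t ≡ m → Around t (1 + t) 0

  around : ∀ v → Around (toℕ (prv v)) (toℕ v) (toℕ (nxt v))
  around v = from-↦ (↦-prv v) (↦-nxt v) (toℕ<n (nxt v))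
    where
    from-↦ : ∀ {p t q} → p ↦ t → t ↦ q → q < suc m → Around p t q
    from-↦ (inj₂ (refl , refl)) (inj₁ refl)        _   = first
    from-↦ (inj₂ (refl , _))    (inj₂ (_ , 1≡1+m)) _   = contradiction (sym (suc-injective 1≡1+m)) m≢0
    from-↦ (inj₁ refl)          (inj₁ refl)        q<n = middle (s≤s⁻¹ q<n)
    from-↦ (inj₁ refl)          (inj₂ (refl , e))  _   = last (suc-injective e)

  module _ {C : Set} (κ : ℕ → C) (W : C → C → C → Set)
           (window : ∀ {p t q} → Around p t q → W (κ p) (κ t) (κ q))
           {Q : C → Set} (Q? : Decidable Q) where

    pullback-IsTRD : TRDWindows Q? W → IsTRD Adj (λ v → Q (κ (toℕ v)))
    pullback-IsTRD ok = TRDAt⇒IsTRD λ v →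
      Equivalence.to (trdWindow-reflects (Q? _) (Q? _) (Q? _))
                     (ok {κ (toℕ (prv v))} {κ (toℕ v)} {κ (toℕ (nxt v))} (window (around v)))

    pullback-¬IsTRD : (v : Vertex) {s : C} → κ (toℕ v) ≡ s →
                      (∀ {a c} → W a s c → trdWindow (does (Q? a)) (does (Q? s)) (does (Q? c)) ≡ false) →
                      ¬ IsTRD Adj (λ v → Q (κ (toℕ v)))
    pullback-¬IsTRD v refl bad trd
      with trans (sym (bad {κ (toℕ (prv v))} {κ (toℕ (nxt v))} (window (around v))))
                 (Equivalence.from (trdWindow-reflects (Q? _) (Q? _) (Q? _))
                                   (IsTRD⇒TRDAt (λ u → Q? (κ (toℕ u))) trd v))
    ... | ()

  module _ {k} (f : Vertex → Fin k) where

    TRDUnion : Fin k → Fin k → Set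
    TRDUnion i j = IsTRD Adj (Class f i ∪ Class f j)

    -- As k ≥ 4, some class z ≠ x avoids both neighbours of v (resp. avoids v itself), and then
    -- only class x can supply the neighbours that x ∪ z needs at v.
    universal-class-IsTRD : 4 ≤ k → ∀ x → (∀ z → z ≢ x → TRDUnion x z) → IsTRD Adj (Class f x)
    universal-class-IsTRD 4≤k x unions = TRDAt⇒IsTRD λ v → dominated v , restrained v
      where
      local : ∀ z → z ≢ x → ∀ v → TRDAt (Class f x ∪ Class f z) v
      local z z≢x = IsTRD⇒TRDAt (Class∪? f x z) (unions z z≢x)

      dominated : ∀ v → Dominates (Class f x) v
      dominated v with f (prv v) ≟ᶠ x | f (nxt v) ≟ᶠ x
      ... | yes prv∈x | _         = inj₁ prv∈x
      ... | no _      | yes nxt∈x = inj₂ nxt∈x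
      ... | no prv∉x  | no nxt∉x
        with fresh (x ∷ f (prv v) ∷ f (nxt v) ∷ []) 4≤k
      ... | z , z≢x ∷ z≢fprv ∷ z≢fnxt ∷ [] with proj₁ (local z z≢x v)
      ...   | inj₁ prv∈x∪z = contradiction prv∈x∪z [ prv∉x , z≢fprv ∘ sym ]′
      ...   | inj₂ nxt∈x∪z = contradiction nxt∈x∪z [ nxt∉x , z≢fnxt ∘ sym ]′

      restrained : ∀ v → ¬ Class f x v → Dominates (∁ (Class f x)) v
      restrained v v∉x with fresh (x ∷ f v ∷ []) (≤-trans (n≤1+n 3) 4≤k)
      ... | z , z≢x ∷ z≢fv ∷ [] =
        Sum.map (_∘ inj₁) (_∘ inj₁) (proj₂ (local z z≢x v) [ v∉x , z≢fv ∘ sym ]′)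

    ¬IsTRCPartition : 4 ≤ k → NoDisjointEdges TRDUnion → ¬ IsTRCPartition Adj f
    ¬IsTRCPartition 4≤k no-disjoint (_ , alone , coalition) =
      let x , universal = universal-vertex {E = TRDUnion} IsTRD-∪-comm partner no-disjoint 4≤k
      in alone x (universal-class-IsTRD 4≤k x universal)
      where
      partner : ∀ i → ∃ λ j → j ≢ i × TRDUnion i j
      partner i = let j , j≢i , _ , _ , union = coalition i in j , j≢i , union

    disjoint-unions : ∀ {a b c d} → c ≢ a → c ≢ b → d ≢ a → d ≢ b →
                      ∀ v → (Class f a ∪ Class f b) v → (Class f c ∪ Class f d) v → ⊥
    disjoint-unions c≢a _   _   _   _ (inj₁ refl) (inj₁ fv≡c) = c≢a (sym fv≡c)
    disjoint-unions _   _   d≢a _   _ (inj₁ refl) (inj₂ fv≡d) = d≢a (sym fv≡d)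
    disjoint-unions _   c≢b _   _   _ (inj₂ refl) (inj₁ fv≡c) = c≢b (sym fv≡c)
    disjoint-unions _   _   _   d≢b _ (inj₂ refl) (inj₂ fv≡d) = d≢b (sym fv≡d)

    -- Two disjoint TRD-unions leave no vertex for a fifth class.
    five-classes⇒NoDisjointEdges : 5 ≤ k → IsTRCPartition Adj f → NoDisjointEdges TRDUnion
    five-classes⇒NoDisjointEdges 5≤k (surjective , _) {a} {b} {c} {d} ab cd c≢a c≢b d≢a d≢b
      with fresh (a ∷ b ∷ c ∷ d ∷ []) 5≤k
    ... | e , e≢a ∷ e≢b ∷ e≢c ∷ e≢d ∷ [] =
      disjoint-totallyDominating-cover (IsTRD⇒TotallyDominating (Class∪? f a b) ab)
        (IsTRD⇒TotallyDominating (Class∪? f c d) cd) (disjoint-unions c≢a c≢b d≢a d≢b)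
        v [ e≢a ∘ of-class-e , e≢b ∘ of-class-e ]′ [ e≢c ∘ of-class-e , e≢d ∘ of-class-e ]′
      where
      v : Vertex
      v = proj₁ (surjective e)

      of-class-e : ∀ {i} → f v ≡ i → e ≡ i
      of-class-e = trans (sym (proj₂ (surjective e) refl))

    ¬4∣n⇒NoDisjointEdges : ¬ 4 ∣ suc m → NoDisjointEdges TRDUnion
    ¬4∣n⇒NoDisjointEdges ¬4∣n {a} {b} {c} {d} ab cd c≢a c≢b d≢a d≢b =
      ¬4∣n (disjoint-totallyDominating⇒4∣n (Class∪? f a b) (IsTRD⇒TotallyDominating (Class∪? f a b) ab)
              (IsTRD⇒TotallyDominating (Class∪? f c d) cd) (disjoint-unions c≢a c≢b d≢a d≢b))

  trcPartition-order≤4 : ∀ {k} → HasTRCPartition Adj k → k ≤ 4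
  trcPartition-order≤4 (f , partition) = ≮⇒≥ λ 5≤k →
    ¬IsTRCPartition f (≤-trans (n≤1+n 4) 5≤k) (five-classes⇒NoDisjointEdges f 5≤k partition) partition

  trcPartition-order≤3 : ¬ 4 ∣ suc m → ∀ {k} → HasTRCPartition Adj k → k ≤ 3
  trcPartition-order≤3 ¬4∣n (f , partition) = ≮⇒≥ λ 4≤k →
    ¬IsTRCPartition f 4≤k (¬4∣n⇒NoDisjointEdges f ¬4∣n) partition

-- Colourings of the cycle by position

rot : Fin 4 → Fin 4
rot zero                   = suc zero
rot (suc zero)             = suc (suc zero)
rot (suc (suc zero))       = suc (suc (suc zero))
rot (suc (suc (suc zero))) = zero

rot⁴ : ∀ i → rot (rot (rot (rot i))) ≡ i
rot⁴ zero                   = refl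
rot⁴ (suc zero)             = refl
rot⁴ (suc (suc zero))       = refl
rot⁴ (suc (suc (suc zero))) = refl

residue₄ : ℕ → Fin 4
residue₄ zero    = zero
residue₄ (suc t) = rot (residue₄ t)

residue₄-multiple : ∀ q → residue₄ (q * 4) ≡ zero
residue₄-multiple zero    = refl
residue₄-multiple (suc q) = trans (rot⁴ (residue₄ (q * 4))) (residue₄-multiple q)

residue₄-toℕ : ∀ i → residue₄ (toℕ i) ≡ i
residue₄-toℕ zero                   = refl
residue₄-toℕ (suc zero)             = refl
residue₄-toℕ (suc (suc zero))       = refl
residue₄-toℕ (suc (suc (suc zero))) = refl

data Window₄ : Fin 4 → Fin 4 → Fin 4 → Set where
  w₃₀₁ : Window₄ (# 3) (# 0) (# 1)
  w₀₁₂ : Window₄ (# 0) (# 1) (# 2)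
  w₁₂₃ : Window₄ (# 1) (# 2) (# 3)
  w₂₃₀ : Window₄ (# 2) (# 3) (# 0)

rot-window : ∀ a → Window₄ a (rot a) (rot (rot a))
rot-window zero                   = w₀₁₂
rot-window (suc zero)             = w₁₂₃
rot-window (suc (suc zero))       = w₂₃₀
rot-window (suc (suc (suc zero))) = w₃₀₁

pair₄ : Fin 4 → Fin 4
pair₄ zero                   = # 1
pair₄ (suc zero)             = # 0
pair₄ (suc (suc zero))       = # 3
pair₄ (suc (suc (suc zero))) = # 2

pair₄≢ : ∀ i → pair₄ i ≢ i
pair₄≢ zero                   ()
pair₄≢ (suc zero)             ()
pair₄≢ (suc (suc zero))       ()
pair₄≢ (suc (suc (suc zero))) ()

clamp₄ : ℕ → Fin 5
clamp₄ 0                            = # 0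
clamp₄ 1                            = # 1
clamp₄ 2                            = # 2
clamp₄ 3                            = # 3
clamp₄ (suc (suc (suc (suc _)))) = # 4

clamp₄-toℕ : ∀ i → clamp₄ (toℕ i) ≡ i
clamp₄-toℕ zero                         = refl
clamp₄-toℕ (suc zero)                   = refl
clamp₄-toℕ (suc (suc zero))             = refl
clamp₄-toℕ (suc (suc (suc zero)))       = refl
clamp₄-toℕ (suc (suc (suc (suc zero)))) = refl

data Window₅ : Fin 5 → Fin 5 → Fin 5 → Set where
  w₄₀₁ : Window₅ (# 4) (# 0) (# 1)
  w₀₁₂ : Window₅ (# 0) (# 1) (# 2)
  w₁₂₃ : Window₅ (# 1) (# 2) (# 3)
  w₂₃₄ : Window₅ (# 2) (# 3) (# 4)
  w₃₄₄ : Window₅ (# 3) (# 4) (# 4)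
  w₄₄₄ : Window₅ (# 4) (# 4) (# 4)
  w₃₄₀ : Window₅ (# 3) (# 4) (# 0)
  w₄₄₀ : Window₅ (# 4) (# 4) (# 0)

-- The arcs {0, 1}, {2, 3} and {4, …, n − 1} of the cycle, as classes of clamp₄.
arc : Fin 5 → Fin 3
arc zero                         = # 0
arc (suc zero)                   = # 0
arc (suc (suc zero))             = # 1
arc (suc (suc (suc zero)))       = # 1
arc (suc (suc (suc (suc zero)))) = # 2

pair₃ : Fin 3 → Fin 3
pair₃ zero             = # 2
pair₃ (suc zero)       = # 2
pair₃ (suc (suc zero)) = # 0

pair₃≢ : ∀ i → pair₃ i ≢ i
pair₃≢ zero             ()
pair₃≢ (suc zero)       ()
pair₃≢ (suc (suc zero)) ()

module Constructions (m : ℕ) (m≢0 : m ≢ 0) where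

  open Cycle m m≢0

  vertexAt : ∀ {j} → j ≤ m → Fin (suc j) → Vertex
  vertexAt j≤m i = fromℕ< (s≤s (≤-trans (s≤s⁻¹ (toℕ<n i)) j≤m))

  toℕ-vertexAt : ∀ {j} (j≤m : j ≤ m) (i : Fin (suc j)) → toℕ (vertexAt j≤m i) ≡ toℕ i
  toℕ-vertexAt j≤m i = toℕ-fromℕ< (s≤s (≤-trans (s≤s⁻¹ (toℕ<n i)) j≤m))

  residue-trcPartition : 3 ≤ m → 4 ∣ suc m → IsTRCPartition Adj (residue₄ ∘ toℕ)
  residue-trcPartition 3≤m (divides q n≡q*4) =
    IsTRCPartition-intro (λ i → vertexAt 3≤m i , colour i) alone pair₄ pair₄≢ together
    where
    wrap : residue₄ (suc m) ≡ zero
    wrap = trans (cong residue₄ n≡q*4) (residue₄-multiple q)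

    window : ∀ {p t q} → Around p t q → Window₄ (residue₄ p) (residue₄ t) (residue₄ q)
    window first            = subst (λ z → Window₄ (residue₄ m) z (rot z)) wrap (rot-window (residue₄ m))
    window (middle _)       = rot-window _
    window (last {t} 1+t≡m) = subst (Window₄ (residue₄ t) (rot (residue₄ t)))
                                (trans (cong (residue₄ ∘ suc) 1+t≡m) wrap) (rot-window (residue₄ t))

    colour : ∀ i → residue₄ (toℕ (vertexAt 3≤m i)) ≡ i
    colour i = trans (cong residue₄ (toℕ-vertexAt 3≤m i)) (residue₄-toℕ i)

    isolated : ∀ i {a c} → Window₄ a i c →
               trdWindow (does (a ≟ᶠ i)) (does (i ≟ᶠ i)) (does (c ≟ᶠ i)) ≡ false
    isolated _ w₃₀₁ = refl
    isolated _ w₀₁₂ = refl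
    isolated _ w₁₂₃ = refl
    isolated _ w₂₃₀ = refl

    alone : ∀ i → ¬ IsTRD Adj (Class (residue₄ ∘ toℕ) i)
    alone i = pullback-¬IsTRD residue₄ Window₄ window (Class? id i) (vertexAt 3≤m i) (colour i) (isolated i)

    paired : ∀ i → TRDWindows (Class∪? id i (pair₄ i)) Window₄
    paired zero                   = λ { w₃₀₁ → refl ; w₀₁₂ → refl ; w₁₂₃ → refl ; w₂₃₀ → refl }
    paired (suc zero)             = λ { w₃₀₁ → refl ; w₀₁₂ → refl ; w₁₂₃ → refl ; w₂₃₀ → refl }
    paired (suc (suc zero))       = λ { w₃₀₁ → refl ; w₀₁₂ → refl ; w₁₂₃ → refl ; w₂₃₀ → refl }
    paired (suc (suc (suc zero))) = λ { w₃₀₁ → refl ; w₀₁₂ → refl ; w₁₂₃ → refl ; w₂₃₀ → refl }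

    together : ∀ i → IsTRD Adj (Class (residue₄ ∘ toℕ) i ∪ Class (residue₄ ∘ toℕ) (pair₄ i))
    together i = pullback-IsTRD residue₄ Window₄ window (Class∪? id i (pair₄ i)) (paired i)

  arc-trcPartition : 4 ≤ m → IsTRCPartition Adj (arc ∘ clamp₄ ∘ toℕ)
  arc-trcPartition 4≤m = IsTRCPartition-intro surjective alone pair₃ pair₃≢ together
    where
    at : Fin 5 → Vertex
    at = vertexAt 4≤m

    clamp₄-at : ∀ i → clamp₄ (toℕ (at i)) ≡ i
    clamp₄-at i = trans (cong clamp₄ (toℕ-vertexAt 4≤m i)) (clamp₄-toℕ i)

    clamp₄-≥4 : ∀ {t} → 4 ≤ t → clamp₄ t ≡ # 4
    clamp₄-≥4 (s≤s (s≤s (s≤s (s≤s _)))) = refl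

    last-window : ∀ {t} → 3 ≤ t → Window₅ (clamp₄ t) (clamp₄ (1 + t)) (# 0)
    last-window {1}                       (s≤s ())
    last-window {2}                       (s≤s (s≤s ()))
    last-window {3}                       _ = w₃₄₀
    last-window {suc (suc (suc (suc _)))} _ = w₄₄₀

    window : ∀ {p t q} → Around p t q → Window₅ (clamp₄ p) (clamp₄ t) (clamp₄ q)
    window first                                = subst (λ a → Window₅ a (# 0) (# 1))
                                                    (sym (clamp₄-≥4 4≤m)) w₄₀₁
    window (middle {0} _)                       = w₀₁₂
    window (middle {1} _)                       = w₁₂₃
    window (middle {2} _)                       = w₂₃₄
    window (middle {3} _)                       = w₃₄₄
    window (middle {suc (suc (suc (suc _)))} _) = w₄₄₄
    window (last 1+t≡m)                         = last-window (s≤s⁻¹ (subst (4 ≤_) (sym 1+t≡m) 4≤m))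

    surjective : StrictlySurjective _≡_ (arc ∘ clamp₄ ∘ toℕ)
    surjective zero             = at (# 0) , cong arc (clamp₄-at (# 0))
    surjective (suc zero)       = at (# 2) , cong arc (clamp₄-at (# 2))
    surjective (suc (suc zero)) = at (# 4) , cong arc (clamp₄-at (# 4))

    alone : ∀ i → ¬ IsTRD Adj (Class (arc ∘ clamp₄ ∘ toℕ) i)
    alone zero             = pullback-¬IsTRD clamp₄ Window₅ window (Class? arc (# 0)) (at (# 3)) (clamp₄-at (# 3))
                               λ { w₂₃₄ → refl }
    alone (suc zero)       = pullback-¬IsTRD clamp₄ Window₅ window (Class? arc (# 1)) (at (# 0)) (clamp₄-at (# 0))
                               λ { w₄₀₁ → refl }
    alone (suc (suc zero)) = pullback-¬IsTRD clamp₄ Window₅ window (Class? arc (# 2)) (at (# 1)) (clamp₄-at (# 1))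
                               λ { w₀₁₂ → refl }

    paired : ∀ i → TRDWindows (Class∪? arc i (pair₃ i)) Window₅
    paired zero             = λ { w₄₀₁ → refl ; w₀₁₂ → refl ; w₁₂₃ → refl ; w₂₃₄ → refl
                                ; w₃₄₄ → refl ; w₄₄₄ → refl ; w₃₄₀ → refl ; w₄₄₀ → refl }
    paired (suc zero)       = λ { w₄₀₁ → refl ; w₀₁₂ → refl ; w₁₂₃ → refl ; w₂₃₄ → refl
                                ; w₃₄₄ → refl ; w₄₄₄ → refl ; w₃₄₀ → refl ; w₄₄₀ → refl }
    paired (suc (suc zero)) = λ { w₄₀₁ → refl ; w₀₁₂ → refl ; w₁₂₃ → refl ; w₂₃₄ → refl
                                ; w₃₄₄ → refl ; w₄₄₄ → refl ; w₃₄₀ → refl ; w₄₄₀ → refl }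

    together : ∀ i → IsTRD Adj (Class (arc ∘ clamp₄ ∘ toℕ) i ∪ Class (arc ∘ clamp₄ ∘ toℕ) (pair₃ i))
    together i = pullback-IsTRD clamp₄ Window₅ window (Class∪? arc i (pair₃ i)) (paired i)

theorem3p10 : (n : ℕ) → 4 ≤ n →
    (n % 4 ≡ 0 → CtrIs (CycleAdj n) 4) × (¬ (n % 4 ≡ 0) → CtrIs (CycleAdj n) 3)
theorem3p10 (suc m) (s≤s 3≤m) = divisible , indivisible
  where
  m≢0 : m ≢ 0
  m≢0 m≡0 = contradiction (subst (3 ≤_) m≡0 3≤m) λ ()

  open Cycle m m≢0
  open Constructions m m≢0

  divisible : suc m % 4 ≡ 0 → CtrIs Adj 4
  divisible n%4≡0 =
    (residue₄ ∘ toℕ , residue-trcPartition 3≤m (m%n≡0⇒n∣m (suc m) 4 n%4≡0)) , λ _ → trcPartition-order≤4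

  -- n = 4 is divisible by 4, so here n ≥ 5.
  indivisible : ¬ (suc m % 4 ≡ 0) → CtrIs Adj 3
  indivisible n%4≢0 =
    (arc ∘ clamp₄ ∘ toℕ , arc-trcPartition (≤∧≢⇒< 3≤m λ { refl → n%4≢0 refl })) ,
    λ _ → trcPartition-order≤3 (n%4≢0 ∘ n∣m⇒m%n≡0 (suc m) 4)
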